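{- Let $P$ be a program satisfying the assumptions below (definite, flattened, moded, directly recursive) and let $\le$ be any total order on argument profiles. Then the sequence of environments $\Phi_0,\Phi_1,\Phi_2,\dots$ computed by the analysis algorithm below is convergent: it is finite, i.e. the algorithm terminates, equivalently there is $N$ such that no further environment is produced after $\Phi_N$.
   Context: Language. Fix finite sets of variables, function symbols $\mathcal{F}$ and predicate symbols. A program $P$ is a finite set of predicate definitions; all clauses of a predicate $p$ share the same head $p(X_1,\dots,X_n)$ with distinct variables, $\mathit{args}(p)_i=X_i$, and each argument is designated input or output. Clause bodies are conjunctions of atoms, each carrying a unique program point in $\mathbb{N}$, of the forms: a call $q(Y_1,\dots,Y_m)$ with variable arguments (its input/output arguments $\mathit{inargs},\mathit{outargs}$ are those in the input/output positions of $q$); a deconstruction $V\Rightarrow f(Y_1,\dots,Y_n)$; a construction $V\Leftarrow f(Y_1,\dots,Y_n)$; a test $V\leftrightarrow W$; an assignment $V:=W$. The program is directly recursive: the call graph has no cycles other than self-loops (a predicate may call itself). Operations. $B=\{:=,\leftrightarrow\}\cup\bigcup_{f\in\mathcal{F}}\{\Leftarrow_f,\Rightarrow_f\}$. For a set of operations $S$, an argument profile for an $n$-ary operation is a finite set of pairs $(o,j)$ with $o$ a (multi)set of elements of $S$ and $j\in\{1,\dots,n\}$. $R(S)=B\cup\{\psi_\bot\}\cup\{\psi(\alpha_1,\dots,\alpha_n): n\ge1,\ \alpha_i$ argument profiles for $n$-ary operations w.r.t. $S\}$; operations are elements of $\mathrm{lfp}(R)$. Interaction sets. An interaction in $p$ is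 $V\overset{O}{\rightsquigarrow}\hat V$ with $V,\hat V$ variables of $p$ and $O\subseteq\mathrm{lfp}(R)\times\mathbb{N}$ (operation, program point). A well-defined interaction set for $p$ is a set $\phi$ of interactions with: $V\ne\hat V$; at most one interaction per ordered pair $(V,\hat V)$; $\hat V$ is not an input argument of $p$. Join: $(V\overset{O}{\rightsquigarrow}\hat V)\sqcup\phi$ adds the interaction if no interaction from $V$ to $\hat V$ is in $\phi$, otherwise replaces $V\overset{O'}{\rightsquigarrow}\hat V$ by $V\overset{O\cup O'}{\rightsquigarrow}\hat V$; $\phi\sqcup\phi'$ adds all interactions of $\phi$ to $\phi'$ this way; $\bot=\emptyset$. For a predicate profile $\phi$ of $p/n$ (interactions only between formal arguments), the argument profile of the $i$th argument is $\alpha_i=\{(O,j): X_i\overset{O}{\rightsquigarrow}X_j\in\phi\}$ (with program points dropped, $O$ viewed as a multiset of operations), and $\mathrm{oprof}(\phi)$ is the permutation of $\langle\alpha_1,\dots,\alpha_n\rangle$ sorted by $\le$. Atom analysis, for an environment $\Phi$ mapping predicates to interaction sets: $\mathbb{A}[V\Rightarrow f(Y_1..Y_n)]\Phi=\bigsqcup_i\{V\overset{\{\Rightarrow_f\}}{\rightsquigarrow}Y_i\}$; $\mathbb{A}[V\Leftarrow f(Y_1..Y_n)]\Phi=\bigsqcup_i\{Y_i\overset{\{\Leftarrow_f\}}{\rightsquigarrow}V\}$; $\mathbb{A}[V:=W]\Phi=\{W\overset{\{:=\}}{\rightsquigarrow}V\}$; $\mathbb{A}[V\leftrightarrow W]\Phi=\emptyset$;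 $\mathbb{A}[q(Y_1..Y_m)]\Phi=\Phi(q)\rho\sqcup\phi_q$ where $\rho$ renames $\mathit{args}(q)_k$ to $Y_k$ and $\phi_q=\{Y_i\overset{\{o\}}{\rightsquigarrow}Y_j: Y_i$ input, $Y_j$ output argument of the call$\}$ with $o=\psi_\bot$ if the call is directly recursive and $o=\psi(\mathrm{oprof}(\Phi(q)))$ otherwise (operations are tagged with the atom's program point). Projection: $T(\phi)=\{X\overset{O\cup O'}{\rightsquigarrow}Z: X\overset{O}{\rightsquigarrow}Y,\ Y\overset{O'}{\rightsquigarrow}Z\in\phi,\ X,Y,Z$ distinct$\}$, $cl_T(\phi)$ the transitive closure obtained by merging such transitive interactions into $\phi$, and $\pi_p(\phi)=\{X\overset{O}{\rightsquigarrow}Y\in cl_T(\phi): X,Y\in\mathit{args}(p)\}$. Predicate analysis: $\mathbb{S}[p]\Phi=\bigsqcup_{(h\leftarrow a_1,\dots,a_n)\in\mathit{def}(p)}\pi_p(\bigsqcup_{i}\mathbb{A}[a_i]\Phi)$. Algorithm: start with $\Phi_0(p)=\bot$ for every $p$, $PS=P$, $i=0$. While some predicate in $PS$ is eligible (all predicates it calls, other than itself, have already been removed from $PS$): select such $p$; while $\mathbb{S}[p]\Phi_i\neq\Phi_i(p)$, set $\Phi_{i+1}$ equal to $\Phi_i$ except $\Phi_{i+1}(p)=\mathbb{S}[p]\Phi_i$, and $i\gets i+1$; then remove $p$ from $PS$. -}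

module Defs where

open import Level using (0ℓ)
open import Data.Nat as ℕ using (ℕ; zero; suc; _*_; _+_)
open import Data.Fin as Fin using (Fin; toℕ)
open import Data.Fin.Subset using (Subset; _∈_; _∉_; ⁅_⁆; _─_; ⊤)
open import Data.Bool using (Bool; true; false; _∧_; if_then_else_)
open import Data.Maybe using (Maybe; just; nothing)
open import Data.Product using (_×_; _,_; proj₁; proj₂; Σ; ∃)
open import Data.List as List using (List; []; _∷_; _++_; map; concat; concatMap; foldr; filter; length; deduplicate)
open import Data.List.Relation.Unary.Any using (Any; any?)
import Data.List.Membership.Propositional as Mem
open import Data.List.Relation.Unary.Unique.Propositional using (Unique)
open import Data.Vec as Vec using (Vec; lookup; toList)
open import Relation.Binary.PropositionalEquality using (_≡_; _≢_; refl; cong; cong₂)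
open import Relation.Binary.Definitions using (DecidableEquality)
open import Relation.Binary.Structures using (IsDecTotalOrder)
open import Relation.Binary.Bundles using (DecTotalOrder)
open import Relation.Binary.Core using (Rel)
open import Relation.Binary.Construct.Closure.Transitive using (TransClosure)
open import Relation.Nullary using (¬_; Dec; yes; no; does)
open import Relation.Nullary.Decidable using (_×-dec_; ¬?)
open import Data.Product.Properties using (≡-dec)
import Data.List.Properties as LP
import Data.Nat.Properties as NP
import Data.Fin.Properties as FP
open import Function using (_⇔_)

data Mode : Set where
  input output : Mode

isInput : Mode → Bool
isInput input  = true
isInput output = false

isOutput : Mode → Bool
isOutput input  = false
isOutput output = true

module _ {nF : ℕ} where

  -- Operations: the elements of lfp(R).
  --   assignOp = :=, testOp = ↔, consOp f = ⇐_f, deconsOp f = ⇒_f,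
  --   psiBot = ψ_⊥, psi αs = ψ(α₁,…,αₙ).
  -- An argument profile is a finite set of pairs (o , j), o a multiset
  -- of operations, represented by lists.

  data Op : Set where
    assignOp testOp : Op
    consOp deconsOp : Fin nF → Op
    psiBot : Op
    psi    : List (List (List Op × ℕ)) → Op

module _ (nF : ℕ) where
  ArgProfile : Set
  ArgProfile = List (List (Op {nF}) × ℕ)

module _ {nF : ℕ} where

  infix 4 _≟op_
  mutual
    _≟op_ : DecidableEquality (Op {nF})
    assignOp ≟op assignOp = yes refl
    assignOp ≟op testOp = no λ ()
    assignOp ≟op consOp _ = no λ ()
    assignOp ≟op deconsOp _ = no λ ()
    assignOp ≟op psiBot = no λ ()
    assignOp ≟op psi _ = no λ ()
    testOp ≟op assignOp = no λ ()
    testOp ≟op testOp = yes refl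
    testOp ≟op consOp _ = no λ ()
    testOp ≟op deconsOp _ = no λ ()
    testOp ≟op psiBot = no λ ()
    testOp ≟op psi _ = no λ ()
    consOp _ ≟op assignOp = no λ ()
    consOp _ ≟op testOp = no λ ()
    consOp f ≟op consOp g with f Fin.≟ g
    ... | yes refl = yes refl
    ... | no f≢g = no λ { refl → f≢g refl }
    consOp _ ≟op deconsOp _ = no λ ()
    consOp _ ≟op psiBot = no λ ()
    consOp _ ≟op psi _ = no λ ()
    deconsOp _ ≟op assignOp = no λ ()
    deconsOp _ ≟op testOp = no λ ()
    deconsOp _ ≟op consOp _ = no λ ()
    deconsOp f ≟op deconsOp g with f Fin.≟ g
    ... | yes refl = yes refl
    ... | no f≢g = no λ { refl → f≢g refl }
    deconsOp _ ≟op psiBot = no λ ()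
    deconsOp _ ≟op psi _ = no λ ()
    psiBot ≟op assignOp = no λ ()
    psiBot ≟op testOp = no λ ()
    psiBot ≟op consOp _ = no λ ()
    psiBot ≟op deconsOp _ = no λ ()
    psiBot ≟op psiBot = yes refl
    psiBot ≟op psi _ = no λ ()
    psi _ ≟op assignOp = no λ ()
    psi _ ≟op testOp = no λ ()
    psi _ ≟op consOp _ = no λ ()
    psi _ ≟op deconsOp _ = no λ ()
    psi _ ≟op psiBot = no λ ()
    psi as ≟op psi bs with ≟profs as bs
    ... | yes refl = yes refl
    ... | no ne = no λ { refl → ne refl }

    ≟profs : DecidableEquality (List (ArgProfile nF))
    ≟profs [] [] = yes refl
    ≟profs [] (_ ∷ _) = no λ ()
    ≟profs (_ ∷ _) [] = no λ ()
    ≟profs (a ∷ as) (b ∷ bs) with ≟prof a b | ≟profs as bs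
    ... | yes refl | yes refl = yes refl
    ... | no ne | _ = no λ { refl → ne refl }
    ... | _ | no ne = no λ { refl → ne refl }

    ≟prof : DecidableEquality (ArgProfile nF)
    ≟prof [] [] = yes refl
    ≟prof [] (_ ∷ _) = no λ ()
    ≟prof (_ ∷ _) [] = no λ ()
    ≟prof ((o , j) ∷ as) ((o' , j') ∷ bs) with ≟ops o o' | j NP.≟ j' | ≟prof as bs
    ... | yes refl | yes refl | yes refl = yes refl
    ... | no ne | _ | _ = no λ { refl → ne refl }
    ... | _ | no ne | _ = no λ { refl → ne refl }
    ... | _ | _ | no ne = no λ { refl → ne refl }

    ≟ops : DecidableEquality (List (Op {nF}))
    ≟ops [] [] = yes refl
    ≟ops [] (_ ∷ _) = no λ ()
    ≟ops (_ ∷ _) [] = no λ ()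
    ≟ops (a ∷ as) (b ∷ bs) with a ≟op b | ≟ops as bs
    ... | yes refl | yes refl = yes refl
    ... | no ne | _ = no λ { refl → ne refl }
    ... | _ | no ne = no λ { refl → ne refl }

  -- operations tagged with a program point
  OpPP : Set
  OpPP = Op {nF} × ℕ

  _≟opp_ : DecidableEquality OpPP
  _≟opp_ = ≡-dec _≟op_ NP._≟_

  _∪O_ : List OpPP → List OpPP → List OpPP
  O ∪O O' = deduplicate _≟opp_ (O ++ O')

module _ (nV nF nP : ℕ) where

  Var  = Fin nV
  Fun  = Fin nF
  Pred = Fin nP

  -- atoms, each carrying its program point (the ℕ field);
  -- `ar` gives the arity of each predicate symbol
  data Atom (ar : Pred → ℕ) : Set where
    call    : (pp : ℕ) (q : Pred) → Vec Var (ar q) → Atom ar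
    decons  : (pp : ℕ) → Var → Fun → List Var → Atom ar
    cons    : (pp : ℕ) → Var → Fun → List Var → Atom ar
    test    : (pp : ℕ) → Var → Var → Atom ar
    assign  : (pp : ℕ) → Var → Var → Atom ar

  -- A program: every predicate symbol p has arity `arity p`, head
  -- p(X₁,…,Xₙ) with X_i = lookup (args p) i, modes, and a list of clause
  -- bodies (each body a list = conjunction of atoms).
  record Program : Set where
    field
      arity   : Pred → ℕ
      args    : (p : Pred) → Vec Var (arity p)
      mode    : (p : Pred) → Vec Mode (arity p)
      clauses : Pred → List (List (Atom arity))

module _ {nV nF nP : ℕ} where

  progPoint : ∀ {ar} → Atom nV nF nP ar → ℕ
  progPoint (call pp _ _) = pp
  progPoint (decons pp _ _ _) = pp
  progPoint (cons pp _ _ _) = pp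
  progPoint (test pp _ _) = pp
  progPoint (assign pp _ _) = pp

  module _ (P : Program nV nF nP) where
    open Program P

    allAtoms : List (Atom nV nF nP arity)
    allAtoms = concatMap (λ p → concat (clauses p)) (List.allFin nP)

    HeadsDistinct : Set
    HeadsDistinct = ∀ p (i j : Fin (arity p)) → lookup (args p) i ≡ lookup (args p) j → i ≡ j

    UniqueProgramPoints : Set
    UniqueProgramPoints = Unique (map progPoint allAtoms)

    Calls : Pred nV nF nP → Pred nV nF nP → Set
    Calls p q = Any (λ body → Any (λ a → ∃ λ pp → ∃ λ ys → a ≡ call pp q ys) body) (clauses p)

    CallsOther : Pred nV nF nP → Pred nV nF nP → Set
    CallsOther p q = Calls p q × p ≢ q

    DirectlyRecursive : Set
    DirectlyRecursive = ∀ p → ¬ TransClosure CallsOther p p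

module _ {nV nF : ℕ} where

  record Interaction : Set where
    constructor _⟿[_]_
    field
      src : Fin nV
      ops : List (OpPP {nF})
      tgt : Fin nV
  open Interaction public

  ISet : Set
  ISet = List Interaction

  ⊥I : ISet
  ⊥I = []

  insertI : Interaction → ISet → ISet
  insertI i [] = i ∷ []
  insertI i (j ∷ φ) with (src i Fin.≟ src j) ×-dec (tgt i Fin.≟ tgt j)
  ... | yes _ = (src j ⟿[ ops i ∪O ops j ] tgt j) ∷ φ
  ... | no  _ = j ∷ insertI i φ

  _⊔_ : ISet → ISet → ISet
  φ ⊔ φ' = foldr insertI φ' φ

  ⨆ : List ISet → ISet
  ⨆ = foldr _⊔_ ⊥I

  lookupI : ISet → Fin nV → Fin nV → Maybe (List (OpPP {nF}))
  lookupI [] V W = nothing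
  lookupI (i ∷ φ) V W with (src i Fin.≟ V) ×-dec (tgt i Fin.≟ W)
  ... | yes _ = just (ops i)
  ... | no  _ = lookupI φ V W

  _≈I_ : ISet → ISet → Set
  φ ≈I ψ = ∀ V W → (Any (λ i → src i ≡ V × tgt i ≡ W) φ ⇔ Any (λ i → src i ≡ V × tgt i ≡ W) ψ)
                 × (∀ x → Any (λ i → src i ≡ V × tgt i ≡ W × Mem._∈_ x (ops i)) φ
                        ⇔ Any (λ i → src i ≡ V × tgt i ≡ W × Mem._∈_ x (ops i)) ψ)

  T : ISet → ISet
  T φ = concatMap (λ a → concatMap (λ b → step a b) φ) φ
    where
    step : Interaction → Interaction → ISet
    step a b with (tgt a Fin.≟ src b) ×-dec ((¬? (src a Fin.≟ tgt a) ×-dec ¬? (tgt a Fin.≟ tgt b)) ×-dec ¬? (src a Fin.≟ tgt b))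
    ... | yes _ = (src a ⟿[ ops a ∪O ops b ] tgt b) ∷ []
    ... | no  _ = []

  iterate : ℕ → (ISet → ISet) → ISet → ISet
  iterate zero    f φ = φ
  iterate (suc n) f φ = iterate n f (f φ)

  opCount : ISet → ℕ
  opCount φ = length (deduplicate _≟opp_ (concatMap ops φ))

  -- Each merge that
  -- changes φ adds a new (pair, tagged operation) combination, of which
  -- there are at most nV * nV * opCount φ, so this many rounds reach the
  -- fixpoint (further rounds do not change it).
  clT : ISet → ISet
  clT φ = iterate (suc (nV * nV * opCount φ)) (λ ψ → T ψ ⊔ ψ) φ

  projTo : ∀ {n} → Vec (Fin nV) n → ISet → ISet
  projTo as φ = filter (λ i → isArg (src i) ×-dec isArg (tgt i)) (clT φ)
    where
    isArg : (x : Fin nV) → Dec (Mem._∈_ x (toList as))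
    isArg x = any? (x Fin.≟_) (toList as)

module Analysis {nV nF nP : ℕ} (P : Program nV nF nP)
                (_≤_ : Rel (ArgProfile nF) 0ℓ)
                (≤-dto : IsDecTotalOrder _≡_ _≤_) where
  open Program P

  IS : Set
  IS = ISet {nV} {nF}

  Env : Set
  Env = Pred nV nF nP → IS

  order : DecTotalOrder 0ℓ 0ℓ 0ℓ
  order = record { Carrier = ArgProfile nF ; _≈_ = _≡_ ; _≤_ = _≤_ ; isDecTotalOrder = ≤-dto }

  open import Data.List.Sort order using (sort)

  argProfile : (q : Pred nV nF nP) → IS → Fin (arity q) → ArgProfile nF
  argProfile q φ i = concatMap entry (List.allFin (arity q))
    where
    entry : Fin (arity q) → ArgProfile nF
    entry j with lookupI φ (lookup (args q) i) (lookup (args q) j)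
    ... | just O  = (map proj₁ O , suc (toℕ j)) ∷ []
    ... | nothing = []

  oprof : (q : Pred nV nF nP) → IS → List (ArgProfile nF)
  oprof q φ = sort (List.map (argProfile q φ) (List.allFin (arity q)))

  rename : ∀ {n} → Vec (Fin nV) n → Vec (Fin nV) n → Fin nV → Fin nV
  rename Vec.[] Vec.[] x = x
  rename (X Vec.∷ Xs) (Y Vec.∷ Ys) x with x Fin.≟ X
  ... | yes _ = Y
  ... | no  _ = rename Xs Ys x

  renameI : ∀ {n} → Vec (Fin nV) n → Vec (Fin nV) n → IS → IS
  renameI Xs Ys φ = ⨆ (map (λ i → (rename Xs Ys (src i) ⟿[ ops i ] rename Xs Ys (tgt i)) ∷ []) φ)

  𝔸 : Pred nV nF nP → Atom nV nF nP arity → Env → IS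
  𝔸 p (decons pp V f Ys) Φ = ⨆ (map (λ Y → (V ⟿[ (deconsOp f , pp) ∷ [] ] Y) ∷ []) Ys)
  𝔸 p (cons pp V f Ys) Φ = ⨆ (map (λ Y → (Y ⟿[ (consOp f , pp) ∷ [] ] V) ∷ []) Ys)
  𝔸 p (assign pp V W) Φ = (W ⟿[ (assignOp , pp) ∷ [] ] V) ∷ []
  𝔸 p (test pp V W) Φ = ⊥I
  𝔸 p (call pp q Ys) Φ = renameI (args q) Ys (Φ q) ⊔ φq
    where
    o : Op {nF}
    o with q Fin.≟ p
    ... | yes _ = psiBot
    ... | no  _ = psi (oprof q (Φ q))
    φq : IS
    φq = ⨆ (concatMap (λ i → concatMap (λ j →
            if isInput (lookup (mode q) i) ∧ isOutput (lookup (mode q) j)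
            then ((lookup Ys i ⟿[ (o , pp) ∷ [] ] lookup Ys j) ∷ []) ∷ []
            else []) (List.allFin (arity q))) (List.allFin (arity q)))

  𝕊 : Pred nV nF nP → Env → IS
  𝕊 p Φ = ⨆ (map (λ body → projTo (args p) (⨆ (map (λ a → 𝔸 p a Φ) body))) (clauses p))

  update : Env → Pred nV nF nP → IS → Env
  update Φ p φ q with q Fin.≟ p
  ... | yes _ = φ
  ... | no  _ = Φ q

  -- The algorithm, as a (nondeterministic) transition system.
  -- State: the set PS of unprocessed predicates, the predicate currently
  -- selected (if any), and the current environment Φ_i.

  record State : Set where
    constructor ⟨_,_,_⟩
    field
      PS  : Subset nP
      cur : Maybe (Pred nV nF nP)
      env : Env

  Eligible : Subset nP → Pred nV nF nP → Set
  Eligible PS p = p ∈ PS × (∀ q → Calls P p q → q ≢ p → q ∉ PS)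

  data Step : State → State → Set where
    select : ∀ {PS Φ p} → Eligible PS p → Step ⟨ PS , nothing , Φ ⟩ ⟨ PS , just p , Φ ⟩
    iter   : ∀ {PS Φ p} → ¬ (𝕊 p Φ ≈I Φ p) → Step ⟨ PS , just p , Φ ⟩ ⟨ PS , just p , update Φ p (𝕊 p Φ) ⟩
    done   : ∀ {PS Φ p} → 𝕊 p Φ ≈I Φ p → Step ⟨ PS , just p , Φ ⟩ ⟨ PS ─ ⁅ p ⁆ , nothing , Φ ⟩

  initial : State
  initial = ⟨ ⊤ , nothing , (λ _ → ⊥I) ⟩

module Submission where

-- While p is iterated, the interaction sets of all other predicates stay
-- fixed, and Φ(p) enters 𝕊[p] only through directly recursive calls, whose
-- operation ψ_⊥ does not depend on Φ.  So 𝕊[p] is monotone in Φ(p) for the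
-- order "holds more facts", and creates no operations beyond the finite list
-- produced by the atoms of p at the moment p was selected.  Starting from
-- Φ(p) = ⊥ the iterates thus ascend in a finite set of facts (a pair of
-- variables, optionally with one operation), and each iteration that changes
-- Φ(p) adds one.  Each predicate is selected once, so the algorithm halts.
-- Neither the order on argument profiles nor the three well-formedness
-- hypotheses on P play any role.

open import Defs
open import Level using (0ℓ)
open import Data.Empty using (⊥-elim)
open import Data.Fin as Fin using (Fin)
import Data.Fin.Subset as Subset
open import Data.Fin.Subset using (Subset; inside; ⁅_⁆; _─_; ∣_∣) renaming (_∈_ to _∈ₛ_; _∉_ to _∉ₛ_)
open import Data.Fin.Subset.Properties using (p─q⊆p; x∈⁅x⁆; x∈p⇒∣p-x∣<∣p∣; ∣p∣≤n)
open import Data.List using (List; []; _∷_; _++_; map; concatMap; filter; length; allFin; cartesianProduct)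
open import Data.List.Properties using (length-removeAt′)
open import Data.List.Membership.Propositional using (_∈_; find; lose)
open import Data.List.Membership.Propositional.Properties
import Data.List.Membership.DecPropositional as DecMembership
open import Data.List.Relation.Unary.Any as Any using (Any; here; there; any?)
import Data.List.Relation.Unary.Any.Properties as Any
import Data.List.Relation.Unary.All as All
open import Data.List.Relation.Unary.AllPairs using (_∷_)
open import Data.List.Relation.Unary.Unique.Propositional using (Unique)
import Data.List.Relation.Unary.Unique.DecPropositional.Properties as Unique
open import Data.Maybe using (Maybe; just; nothing)
open import Data.Nat using (ℕ; zero; suc; _≤_; _<_; z≤n; s≤s; _*_)
import Data.Nat.Properties as ℕ
import Data.Product as Product
open import Data.Product using (_×_; _,_; proj₂; ∃; ∃₂)
import Data.Sum as Sum
open import Data.Sum using (_⊎_; inj₁; inj₂; [_,_]′)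
open import Data.Unit using (⊤; tt)
open import Data.Vec using (Vec; toList; _∷_; here; there)
open import Function using (_∘_; id; flip; mk⇔)
open import Induction.WellFounded using (Acc; acc)
open import Relation.Binary.Core using (Rel; _Preserves_⟶_)
open import Relation.Binary.Structures using (IsDecTotalOrder)
open import Relation.Binary.PropositionalEquality using (_≡_; _≢_; refl; sym; trans; subst)
open import Relation.Nullary using (¬_; Dec; yes; no)
open import Relation.Nullary.Decidable using (_×-dec_; ¬?)

concatMap²⁻ : ∀ {A B C : Set} {P : C → Set} {g : A → B → List C} xs ys
            → Any P (concatMap (λ a → concatMap (g a) ys) xs)
            → ∃₂ λ a b → a ∈ xs × b ∈ ys × Any P (g a b)
concatMap²⁻ xs ys h with find (Any.concatMap⁻ _ h)
... | a , a∈ , h′ with find (Any.concatMap⁻ _ h′)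
... | b , b∈ , h″ = a , b , a∈ , b∈ , h″

concatMap²⁺ : ∀ {A B C : Set} {P : C → Set} {xs ys a b} (g : A → B → List C)
            → a ∈ xs → b ∈ ys → Any P (g a b)
            → Any P (concatMap (λ a → concatMap (g a) ys) xs)
concatMap²⁺ {P = P} {ys = ys} g a∈ b∈ h =
  Any.concatMap⁺ _ (lose {P = λ a → Any P (concatMap (g a) ys)} a∈ (Any.concatMap⁺ _ (lose {P = λ b′ → Any P (g _ b′)} b∈ h)))

∈-─⁺ : ∀ {A : Set} {x z : A} {ys} (x∈ : x ∈ ys) → z ∈ ys → z ≢ x → z ∈ (ys Any.─ x∈)
∈-─⁺ (here refl) (here refl) z≢x = ⊥-elim (z≢x refl)
∈-─⁺ (here refl) (there z∈) z≢x = z∈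
∈-─⁺ (there x∈) (here refl) z≢x = here refl
∈-─⁺ (there x∈) (there z∈) z≢x = there (∈-─⁺ x∈ z∈ z≢x)

Unique∧⊆⇒length≤ : ∀ {A : Set} {xs ys : List A} → Unique xs → (∀ {x} → x ∈ xs → x ∈ ys) → length xs ≤ length ys
Unique∧⊆⇒length≤ {xs = []} _ _ = z≤n
Unique∧⊆⇒length≤ {xs = x ∷ xs} {ys} (x∉xs ∷ xs!) xs⊆ys =
  subst (suc (length xs) ≤_) (sym (length-removeAt′ ys _))
    (s≤s (Unique∧⊆⇒length≤ xs! λ z∈ → ∈-─⁺ x∈ys (xs⊆ys (there z∈)) λ { refl → All.lookup x∉xs z∈ refl }))
  where x∈ys = xs⊆ys (here refl)

x∈p─q⇒x∉q : ∀ {n} {x : Fin n} (p q : Subset n) → x ∈ₛ p ─ q → x ∉ₛ q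
x∈p─q⇒x∉q (_ ∷ p) (inside ∷ q) () here
x∈p─q⇒x∉q (_ ∷ p) (_ ∷ q) (there x∈) (there x∈q) = x∈p─q⇒x∉q p q x∈ x∈q

module _ {nV nF : ℕ} where

  private
    IS  = ISet {nV} {nF}
    Inter = Interaction {nV} {nF}
    Opᵗ = OpPP {nF}

  -- (V , W , nothing) records that some interaction goes from V to W;
  -- (V , W , just x) that it carries the tagged operation x.
  Fact : Set
  Fact = Fin nV × Fin nV × Maybe Opᵗ

  Carries : List Opᵗ → Maybe Opᵗ → Set
  Carries os nothing  = ⊤
  Carries os (just x) = x ∈ os

  infix 4 _supports_ _⊨_ _⊑_ _∈ₒ_

  _supports_ : Inter → Fact → Set
  i supports (V , W , m) = src i ≡ V × tgt i ≡ W × Carries (ops i) m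

  _⊨_ : IS → Fact → Set
  φ ⊨ f = Any (_supports f) φ

  _⊑_ : Rel IS 0ℓ
  φ ⊑ ψ = ∀ {f} → φ ⊨ f → ψ ⊨ f

  _∈ₒ_ : Opᵗ → IS → Set
  x ∈ₒ φ = ∃₂ λ V W → φ ⊨ (V , W , just x)

  OpsWithin : List Opᵗ → IS → Set
  OpsWithin U φ = ∀ {x} → x ∈ₒ φ → x ∈ U

  ⊨-resp : ∀ {φ V V′ W W′ m} → V ≡ V′ → W ≡ W′ → φ ⊨ (V , W , m) → φ ⊨ (V′ , W′ , m)
  ⊨-resp refl refl h = h

  ⊨⁺ : ∀ {φ i m} → i ∈ φ → Carries (ops i) m → φ ⊨ (src i , tgt i , m)
  ⊨⁺ i∈ c = lose i∈ (refl , refl , c)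

  ⊨⇒∈ₒ : ∀ {φ V W x} → φ ⊨ (V , W , just x) → x ∈ₒ φ
  ⊨⇒∈ₒ h = _ , _ , h

  ∈ₒ-mono : ∀ {φ ψ x} → φ ⊑ ψ → x ∈ₒ φ → x ∈ₒ ψ
  ∈ₒ-mono le (V , W , h) = V , W , le h

  ∈ₒ⇒∈concatMap : ∀ {φ x} → x ∈ₒ φ → x ∈ concatMap ops φ
  ∈ₒ⇒∈concatMap (_ , _ , h) = ∈-concatMap⁺ ops (Any.map (proj₂ ∘ proj₂) h)

  ∈concatMap⇒∈ₒ : ∀ {φ x} → x ∈ concatMap ops φ → x ∈ₒ φ
  ∈concatMap⇒∈ₒ {φ} x∈ with find (∈-concatMap⁻ ops {xs = φ} x∈)
  ... | i , i∈ , x∈i = src i , tgt i , ⊨⁺ i∈ x∈i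

  Carries-∪O⁺ : ∀ m os os′ → Carries os m ⊎ Carries os′ m → Carries (os ∪O os′) m
  Carries-∪O⁺ nothing  os os′ _        = tt
  Carries-∪O⁺ (just x) os os′ (inj₁ c) = ∈-deduplicate⁺ _≟opp_ (∈-++⁺ˡ c)
  Carries-∪O⁺ (just x) os os′ (inj₂ c) = ∈-deduplicate⁺ _≟opp_ (∈-++⁺ʳ os c)

  Carries-∪O⁻ : ∀ m os os′ → Carries (os ∪O os′) m → Carries os m ⊎ Carries os′ m
  Carries-∪O⁻ nothing  os os′ _ = inj₁ tt
  Carries-∪O⁻ (just x) os os′ c = ∈-++⁻ os (∈-deduplicate⁻ _≟opp_ (os ++ os′) c)

  insertI⁺ : ∀ {f} i φ → i supports f ⊎ φ ⊨ f → insertI i φ ⊨ f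
  insertI⁺ i [] (inj₁ s) = here s
  insertI⁺ i (j ∷ φ) h with (src i Fin.≟ src j) ×-dec (tgt i Fin.≟ tgt j)
  insertI⁺ {_ , _ , m} i (j ∷ φ) (inj₁ (s , t , c)) | yes (s≡ , t≡) =
    here (trans (sym s≡) s , trans (sym t≡) t , Carries-∪O⁺ m (ops i) (ops j) (inj₁ c))
  insertI⁺ {_ , _ , m} i (j ∷ φ) (inj₂ (here (s , t , c))) | yes _ =
    here (s , t , Carries-∪O⁺ m (ops i) (ops j) (inj₂ c))
  insertI⁺ i (j ∷ φ) (inj₂ (there h)) | yes _ = there h
  insertI⁺ i (j ∷ φ) (inj₁ s)         | no _ = there (insertI⁺ i φ (inj₁ s))
  insertI⁺ i (j ∷ φ) (inj₂ (here s))  | no _ = here s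
  insertI⁺ i (j ∷ φ) (inj₂ (there h)) | no _ = there (insertI⁺ i φ (inj₂ h))

  insertI⁻ : ∀ {f} i φ → insertI i φ ⊨ f → i supports f ⊎ φ ⊨ f
  insertI⁻ i [] (here s) = inj₁ s
  insertI⁻ i (j ∷ φ) h with (src i Fin.≟ src j) ×-dec (tgt i Fin.≟ tgt j)
  insertI⁻ {_ , _ , m} i (j ∷ φ) (here (s , t , c)) | yes (s≡ , t≡)
    with Carries-∪O⁻ m (ops i) (ops j) c
  ... | inj₁ cᵢ = inj₁ (trans s≡ s , trans t≡ t , cᵢ)
  ... | inj₂ cⱼ = inj₂ (here (s , t , cⱼ))
  insertI⁻ i (j ∷ φ) (there h) | yes _ = inj₂ (there h)
  insertI⁻ i (j ∷ φ) (here s)  | no _ = inj₂ (here s)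
  insertI⁻ i (j ∷ φ) (there h) | no _ = Sum.map₂ there (insertI⁻ i φ h)

  ⊔⁺ : ∀ {f} φ ψ → φ ⊨ f ⊎ ψ ⊨ f → φ ⊔ ψ ⊨ f
  ⊔⁺ []      ψ (inj₂ h)         = h
  ⊔⁺ (i ∷ φ) ψ (inj₁ (here s))  = insertI⁺ i (φ ⊔ ψ) (inj₁ s)
  ⊔⁺ (i ∷ φ) ψ (inj₁ (there h)) = insertI⁺ i (φ ⊔ ψ) (inj₂ (⊔⁺ φ ψ (inj₁ h)))
  ⊔⁺ (i ∷ φ) ψ (inj₂ h)         = insertI⁺ i (φ ⊔ ψ) (inj₂ (⊔⁺ φ ψ (inj₂ h)))

  ⊔⁻ : ∀ {f} φ ψ → φ ⊔ ψ ⊨ f → φ ⊨ f ⊎ ψ ⊨ f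
  ⊔⁻ []      ψ h = inj₂ h
  ⊔⁻ (i ∷ φ) ψ h with insertI⁻ i (φ ⊔ ψ) h
  ... | inj₁ s = inj₁ (here s)
  ... | inj₂ h′ = Sum.map₁ there (⊔⁻ φ ψ h′)

  ⨆⁺ : ∀ {f} φs → Any (_⊨ f) φs → ⨆ φs ⊨ f
  ⨆⁺ (φ ∷ φs) (here h)  = ⊔⁺ φ (⨆ φs) (inj₁ h)
  ⨆⁺ (φ ∷ φs) (there h) = ⊔⁺ φ (⨆ φs) (inj₂ (⨆⁺ φs h))

  ⨆⁻ : ∀ {f} φs → ⨆ φs ⊨ f → Any (_⊨ f) φs
  ⨆⁻ (φ ∷ φs) h = [ here , there ∘ ⨆⁻ φs ]′ (⊔⁻ φ (⨆ φs) h)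

  ⊔-mono : ∀ {φ φ′ ψ ψ′} → φ ⊑ φ′ → ψ ⊑ ψ′ → φ ⊔ ψ ⊑ φ′ ⊔ ψ′
  ⊔-mono {φ} {φ′} {ψ} {ψ′} φ⊑φ′ ψ⊑ψ′ h =
    ⊔⁺ φ′ ψ′ (Sum.map φ⊑φ′ ψ⊑ψ′ (⊔⁻ φ ψ h))

  ⊔-∈ₒ : ∀ φ ψ {x} → x ∈ₒ φ ⊔ ψ → x ∈ₒ φ ⊎ x ∈ₒ ψ
  ⊔-∈ₒ φ ψ (V , W , h) = Sum.map ⊨⇒∈ₒ ⊨⇒∈ₒ (⊔⁻ φ ψ h)

  ⊔-∈ₒʳ : ∀ φ ψ {x} → x ∈ₒ ψ → x ∈ₒ φ ⊔ ψ
  ⊔-∈ₒʳ φ ψ (V , W , h) = V , W , ⊔⁺ φ ψ (inj₂ h)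

  ⨆-map-mono : ∀ {A : Set} {g h : A → IS} xs → (∀ a → g a ⊑ h a) → ⨆ (map g xs) ⊑ ⨆ (map h xs)
  ⨆-map-mono {g = g} {h} xs g⊑h k =
    ⨆⁺ (map h xs) (Any.map⁺ (Any.map (g⊑h _) (Any.map⁻ (⨆⁻ (map g xs) k))))

  ⨆-map-∈ₒ : ∀ {A : Set} (g : A → IS) xs {x} → x ∈ₒ ⨆ (map g xs) → Any (λ a → x ∈ₒ g a) xs
  ⨆-map-∈ₒ g xs (V , W , h) = Any.map ⊨⇒∈ₒ (Any.map⁻ (⨆⁻ (map g xs) h))

  relabel : (Fin nV → Fin nV) → IS → IS
  relabel r φ = ⨆ (map (λ i → (r (src i) ⟿[ ops i ] r (tgt i)) ∷ []) φ)

  relabel⁻ : ∀ r φ {V W m} → relabel r φ ⊨ (V , W , m)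
           → ∃₂ λ V′ W′ → r V′ ≡ V × r W′ ≡ W × φ ⊨ (V′ , W′ , m)
  relabel⁻ r φ h with find (Any.map⁻ (⨆⁻ (map _ φ) h))
  ... | i , i∈ , here (s , t , c) = src i , tgt i , s , t , ⊨⁺ i∈ c

  relabel⁺ : ∀ r φ {V W m} → φ ⊨ (V , W , m) → relabel r φ ⊨ (r V , r W , m)
  relabel⁺ r φ h with find h
  ... | i , i∈ , refl , refl , c = ⨆⁺ (map _ φ) (Any.map⁺ (lose i∈ (here (refl , refl , c))))

  relabel-mono : ∀ r → relabel r Preserves _⊑_ ⟶ _⊑_
  relabel-mono r {φ} {ψ} φ⊑ψ h with relabel⁻ r φ h
  ... | _ , _ , refl , refl , h′ = relabel⁺ r ψ (φ⊑ψ h′)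

  relabel-∈ₒ : ∀ r φ {x} → x ∈ₒ relabel r φ → x ∈ₒ φ
  relabel-∈ₒ r φ (_ , _ , h) with relabel⁻ r φ h
  ... | _ , _ , _ , _ , h′ = ⊨⇒∈ₒ h′

  Composable : Inter → Inter → Set
  Composable a b = (tgt a ≡ src b) × ((¬ (src a ≡ tgt a) × ¬ (tgt a ≡ tgt b)) × ¬ (src a ≡ tgt b))

  -- The local function of T composing two interactions, recovered by
  -- unifying T φ against its concatMap shape.
  private
    innerFunction : ∀ {A B C : Set} {g : A → B → List C} xs ys {zs}
                  → concatMap (λ a → concatMap (g a) ys) xs ≡ zs → A → B → List C
    innerFunction {g = g} _ _ _ = g

  compose : IS → Inter → Inter → IS
  compose φ = innerFunction φ φ (refl {x = T φ})

  compose⁺ : ∀ φ {a b f} → Composable a b → (src a ⟿[ ops a ∪O ops b ] tgt b) supports f → compose φ a b ⊨ f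
  compose⁺ φ {a} {b} c s with (tgt a Fin.≟ src b) ×-dec ((¬? (src a Fin.≟ tgt a) ×-dec ¬? (tgt a Fin.≟ tgt b)) ×-dec ¬? (src a Fin.≟ tgt b))
  ... | yes _ = here s
  ... | no ¬c = ⊥-elim (¬c c)

  compose⁻ : ∀ φ {a b f} → compose φ a b ⊨ f → Composable a b × (src a ⟿[ ops a ∪O ops b ] tgt b) supports f
  compose⁻ φ {a} {b} with (tgt a Fin.≟ src b) ×-dec ((¬? (src a Fin.≟ tgt a) ×-dec ¬? (tgt a Fin.≟ tgt b)) ×-dec ¬? (src a Fin.≟ tgt b))
  ... | yes c = λ { (here s) → c , s }
  ... | no _ = λ ()

  TwoStep : IS → Fact → Set
  TwoStep φ (V , W , m) = ∃ λ U → (V ≢ U × U ≢ W × V ≢ W)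
    × (φ ⊨ (V , U , m) × φ ⊨ (U , W , nothing) ⊎ φ ⊨ (V , U , nothing) × φ ⊨ (U , W , m))

  T⁺ : ∀ φ {f} → TwoStep φ f → T φ ⊨ f
  T⁺ φ {_ , _ , m} (U , (V≢U , U≢W , V≢W) , inj₁ (hₐ , h_b)) with find hₐ | find h_b
  ... | a , a∈ , refl , refl , kₐ | b , b∈ , refl , refl , _ =
    concatMap²⁺ (compose φ) a∈ b∈
      (compose⁺ φ (refl , (V≢U , U≢W) , V≢W) (refl , refl , Carries-∪O⁺ m (ops a) (ops b) (inj₁ kₐ)))
  T⁺ φ {_ , _ , m} (U , (V≢U , U≢W , V≢W) , inj₂ (hₐ , h_b)) with find hₐ | find h_b
  ... | a , a∈ , refl , refl , _ | b , b∈ , refl , refl , k_b =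
    concatMap²⁺ (compose φ) a∈ b∈
      (compose⁺ φ (refl , (V≢U , U≢W) , V≢W) (refl , refl , Carries-∪O⁺ m (ops a) (ops b) (inj₂ k_b)))

  T⁻ : ∀ φ {f} → T φ ⊨ f → TwoStep φ f
  T⁻ φ {_ , _ , m} h with concatMap²⁻ {g = compose φ} φ φ h
  ... | a , b , a∈ , b∈ , h′ with compose⁻ φ h′
  ... | (tgtₐ≡src_b , (V≢U , U≢W) , V≢W) , refl , refl , k =
    tgt a , (V≢U , U≢W , V≢W) ,
      Sum.map (λ kₐ → ⊨⁺ a∈ kₐ , b-fact tt) (λ k_b → ⊨⁺ a∈ tt , b-fact k_b) (Carries-∪O⁻ m (ops a) (ops b) k)
    where
    b-fact : ∀ {m} → Carries (ops b) m → φ ⊨ (tgt a , tgt b , m)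
    b-fact k_b = ⊨-resp (sym tgtₐ≡src_b) refl (⊨⁺ b∈ k_b)

  T-mono : T Preserves _⊑_ ⟶ _⊑_
  T-mono {φ} {ψ} φ⊑ψ h with T⁻ φ h
  ... | U , distinct , steps = T⁺ ψ (U , distinct , Sum.map (Product.map φ⊑ψ φ⊑ψ) (Product.map φ⊑ψ φ⊑ψ) steps)

  T-∈ₒ : ∀ φ {x} → x ∈ₒ T φ → x ∈ₒ φ
  T-∈ₒ φ (_ , _ , h) with T⁻ φ h
  ... | _ , _ , inj₁ (hₐ , _)   = ⊨⇒∈ₒ hₐ
  ... | _ , _ , inj₂ (_ , h_b) = ⊨⇒∈ₒ h_b

  module _ {g : IS → IS} where

    iterate-mono : ∀ n → g Preserves _⊑_ ⟶ _⊑_ → iterate n g Preserves _⊑_ ⟶ _⊑_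
    iterate-mono zero    g-mono φ⊑ψ = φ⊑ψ
    iterate-mono (suc n) g-mono φ⊑ψ = iterate-mono n g-mono (g-mono φ⊑ψ)

    iterate-inflationary : ∀ n → (∀ φ → φ ⊑ g φ) → ∀ φ → φ ⊑ iterate n g φ
    iterate-inflationary zero    g-infl φ h = h
    iterate-inflationary (suc n) g-infl φ h = iterate-inflationary n g-infl (g φ) (g-infl φ h)

    iterate-monoˡ : ∀ {n k} → n ≤ k → (∀ φ → φ ⊑ g φ) → ∀ φ → iterate n g φ ⊑ iterate k g φ
    iterate-monoˡ {k = k} z≤n     g-infl φ = iterate-inflationary k g-infl φ
    iterate-monoˡ (s≤s n≤k) g-infl φ = iterate-monoˡ n≤k g-infl (g φ)

    iterate-∈ₒ : ∀ n → (∀ φ {x} → x ∈ₒ g φ → x ∈ₒ φ) → ∀ φ {x} → x ∈ₒ iterate n g φ → x ∈ₒ φ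
    iterate-∈ₒ zero    g-∈ₒ φ x∈ = x∈
    iterate-∈ₒ (suc n) g-∈ₒ φ x∈ = g-∈ₒ φ (iterate-∈ₒ n g-∈ₒ (g φ) x∈)

  private
    closeOnce : IS → IS
    closeOnce ψ = T ψ ⊔ ψ

  opCount-mono : ∀ {φ ψ} → φ ⊑ ψ → opCount φ ≤ opCount ψ
  opCount-mono {φ} {ψ} φ⊑ψ =
    Unique∧⊆⇒length≤ (Unique.deduplicate-! _≟opp_ (concatMap ops φ))
      (∈-deduplicate⁺ _≟opp_ ∘ ∈ₒ⇒∈concatMap ∘ ∈ₒ-mono φ⊑ψ ∘ ∈concatMap⇒∈ₒ ∘ ∈-deduplicate⁻ _≟opp_ (concatMap ops φ))

  -- clT runs a number of rounds that grows with the number of operations,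
  -- so a larger set is closed under at least as many rounds.
  clT-mono : clT Preserves _⊑_ ⟶ _⊑_
  clT-mono {φ} {ψ} φ⊑ψ =
    iterate-monoˡ (s≤s (ℕ.*-monoʳ-≤ (nV * nV) (opCount-mono φ⊑ψ))) closeOnce-inflationary ψ
    ∘ iterate-mono (suc (nV * nV * opCount φ)) closeOnce-mono φ⊑ψ
    where
    closeOnce-mono : closeOnce Preserves _⊑_ ⟶ _⊑_
    closeOnce-mono φ⊑ψ = ⊔-mono (T-mono φ⊑ψ) φ⊑ψ
    closeOnce-inflationary : ∀ φ → φ ⊑ closeOnce φ
    closeOnce-inflationary φ h = ⊔⁺ (T φ) φ (inj₂ h)

  clT-∈ₒ : ∀ φ {x} → x ∈ₒ clT φ → x ∈ₒ φ
  clT-∈ₒ φ = iterate-∈ₒ (suc (nV * nV * opCount φ)) closeOnce-∈ₒ φ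
    where
    closeOnce-∈ₒ : ∀ φ {x} → x ∈ₒ closeOnce φ → x ∈ₒ φ
    closeOnce-∈ₒ φ x∈ = [ T-∈ₒ φ , id ]′ (⊔-∈ₒ (T φ) φ x∈)

  module _ {n} (as : Vec (Fin nV) n) where

    private
      isArg? : ∀ x → Dec (x ∈ toList as)
      isArg? x = any? (x Fin.≟_) (toList as)

      joinsArgs? : ∀ (i : Inter) → Dec (src i ∈ toList as × tgt i ∈ toList as)
      joinsArgs? i = isArg? (src i) ×-dec isArg? (tgt i)

    private
      filter-mono : filter joinsArgs? Preserves _⊑_ ⟶ _⊑_
      filter-mono {χ} {χ′} χ⊑χ′ h with find h
      ... | i , i∈ , refl , refl , k with ∈-filter⁻ joinsArgs? {xs = χ} i∈
      ... | i∈χ , argₛ , argₜ with find (χ⊑χ′ (⊨⁺ i∈χ k))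
      ... | i′ , i′∈ , s , t , k′ =
        lose (∈-filter⁺ joinsArgs? i′∈ (subst (_∈ toList as) (sym s) argₛ , subst (_∈ toList as) (sym t) argₜ))
             (s , t , k′)

    projTo-mono : projTo as Preserves _⊑_ ⟶ _⊑_
    projTo-mono = filter-mono ∘ clT-mono

    projTo-∈ₒ : ∀ φ {x} → x ∈ₒ projTo as φ → x ∈ₒ φ
    projTo-∈ₒ φ (_ , _ , h) = clT-∈ₒ φ (⊨⇒∈ₒ (Any.filter⁻ joinsArgs? h))

  private module DecOps = DecMembership (_≟opp_ {nF})

  Carries? : ∀ os m → Dec (Carries os m)
  Carries? os nothing  = yes tt
  Carries? os (just x) = x DecOps.∈? os

  _⊨?_ : ∀ φ f → Dec (φ ⊨ f)
  φ ⊨? (V , W , m) = any? (λ i → (src i Fin.≟ V) ×-dec (tgt i Fin.≟ W) ×-dec Carries? (ops i) m) φ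

  missing : List Fact → IS → ℕ
  missing []       φ = 0
  missing (f ∷ fs) φ with φ ⊨? f
  ... | yes _ = missing fs φ
  ... | no _  = suc (missing fs φ)

  missing-antimono : ∀ fs {φ ψ} → φ ⊑ ψ → missing fs ψ ≤ missing fs φ
  missing-antimono []       φ⊑ψ = z≤n
  missing-antimono (f ∷ fs) {φ} {ψ} φ⊑ψ with φ ⊨? f | ψ ⊨? f
  ... | yes _  | yes _   = missing-antimono fs φ⊑ψ
  ... | yes φf | no ¬ψf  = ⊥-elim (¬ψf (φ⊑ψ φf))
  ... | no _   | yes _   = ℕ.m≤n⇒m≤1+n (missing-antimono fs φ⊑ψ)
  ... | no _   | no _    = s≤s (missing-antimono fs φ⊑ψ)

  missing-≡⇒⊒ : ∀ fs {φ ψ f} → φ ⊑ ψ → missing fs ψ ≡ missing fs φ → f ∈ fs → ψ ⊨ f → φ ⊨ f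
  missing-≡⇒⊒ (g ∷ fs) {φ} {ψ} φ⊑ψ eq f∈ ψf with φ ⊨? g | ψ ⊨? g
  missing-≡⇒⊒ (g ∷ fs) φ⊑ψ eq (here refl) ψf | yes φg | _ = φg
  missing-≡⇒⊒ (g ∷ fs) φ⊑ψ eq (there f∈) ψf | yes _ | yes _ = missing-≡⇒⊒ fs φ⊑ψ eq f∈ ψf
  ... | yes φg | no ¬ψg = ⊥-elim (¬ψg (φ⊑ψ φg))
  ... | no _   | yes _  = ⊥-elim (ℕ.<⇒≢ (s≤s (missing-antimono fs φ⊑ψ)) eq)
  missing-≡⇒⊒ (g ∷ fs) φ⊑ψ eq (here refl) ψf | no _ | no ¬ψg = ⊥-elim (¬ψg ψf)
  missing-≡⇒⊒ (g ∷ fs) φ⊑ψ eq (there f∈) ψf | no _ | no _ = missing-≡⇒⊒ fs φ⊑ψ (ℕ.suc-injective eq) f∈ ψf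

  factsOver : List Opᵗ → List Fact
  factsOver U = cartesianProduct (allFin nV) (cartesianProduct (allFin nV) (nothing ∷ map just U))

  ∈-factsOver : ∀ {U} V W m → (∀ {x} → m ≡ just x → x ∈ U) → (V , W , m) ∈ factsOver U
  ∈-factsOver V W m m∈U = ∈-cartesianProduct⁺ (∈-allFin V) (∈-cartesianProduct⁺ (∈-allFin W) (opt m m∈U))
    where
    opt : ∀ m → (∀ {x} → m ≡ just x → x ∈ _) → m ∈ (nothing ∷ map just _)
    opt nothing  _   = here refl
    opt (just x) x∈U = there (∈-map⁺ just (x∈U refl))

  ⊑∧⊒⇒≈I : ∀ {φ ψ} → φ ⊑ ψ → ψ ⊑ φ → φ ≈I ψ
  ⊑∧⊒⇒≈I φ⊑ψ ψ⊑φ V W =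
    mk⇔ (toPair ∘ φ⊑ψ ∘ fromPair) (toPair ∘ ψ⊑φ ∘ fromPair) , λ x → mk⇔ φ⊑ψ ψ⊑φ
    where
    toPair : ∀ {χ} → χ ⊨ (V , W , nothing) → Any (λ i → src i ≡ V × tgt i ≡ W) χ
    toPair = Any.map λ (s , t , _) → s , t
    fromPair : ∀ {χ} → Any (λ i → src i ≡ V × tgt i ≡ W) χ → χ ⊨ (V , W , nothing)
    fromPair = Any.map λ (s , t) → s , t , tt

  missing-< : ∀ U {φ ψ} → φ ⊑ ψ → OpsWithin U ψ → ¬ (ψ ≈I φ) → missing (factsOver U) ψ < missing (factsOver U) φ
  missing-< U {φ} {ψ} φ⊑ψ ψ⊆U ψ≉φ =
    ℕ.≤∧≢⇒< (missing-antimono (factsOver U) φ⊑ψ) λ eq → ψ≉φ (⊑∧⊒⇒≈I (ψ⊑φ eq) φ⊑ψ)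
    where
    ψ⊑φ : missing (factsOver U) ψ ≡ missing (factsOver U) φ → ψ ⊑ φ
    ψ⊑φ eq {V , W , m} h = missing-≡⇒⊒ (factsOver U) φ⊑ψ eq (∈-factsOver V W m λ { refl → ψ⊆U (⊨⇒∈ₒ h) }) h

module Termination {nV nF nP : ℕ} (P : Program nV nF nP)
                   (_≼_ : Rel (ArgProfile nF) 0ℓ) (≼-dto : IsDecTotalOrder _≡_ _≼_) where
  open Program P
  open Analysis P _≼_ ≼-dto

  AgreeOff : Pred nV nF nP → Env → Env → Set
  AgreeOff p Φ Ψ = ∀ q → q ≢ p → Φ q ≡ Ψ q

  update-≡ : ∀ Φ p φ → update Φ p φ p ≡ φ
  update-≡ Φ p φ with p Fin.≟ p
  ... | yes _   = refl
  ... | no p≢p = ⊥-elim (p≢p refl)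

  update-≢ : ∀ Φ p φ → AgreeOff p (update Φ p φ) Φ
  update-≢ Φ p φ q q≢p with q Fin.≟ p
  ... | yes q≡p = ⊥-elim (q≢p q≡p)
  ... | no _    = refl

  𝔸-mono : ∀ p a {Φ Ψ} → AgreeOff p Φ Ψ → Φ p ⊑ Ψ p → 𝔸 p a Φ ⊑ 𝔸 p a Ψ
  𝔸-mono p (call pp q Ys) agree Φp⊑Ψp with q Fin.≟ p
  ... | yes refl = ⊔-mono (relabel-mono (rename (args q) Ys) Φp⊑Ψp) id
  ... | no q≢p rewrite agree q q≢p = id
  𝔸-mono p (decons pp V f Ys) _ _ = id
  𝔸-mono p (cons pp V f Ys)   _ _ = id
  𝔸-mono p (test pp V W)      _ _ = id
  𝔸-mono p (assign pp V W)    _ _ = id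

  𝕊-mono : ∀ p {Φ Ψ} → AgreeOff p Φ Ψ → Φ p ⊑ Ψ p → 𝕊 p Φ ⊑ 𝕊 p Ψ
  𝕊-mono p agree Φp⊑Ψp =
    ⨆-map-mono (clauses p) λ body → projTo-mono (args p) (⨆-map-mono body λ a → 𝔸-mono p a agree Φp⊑Ψp)

  𝔸-∈ₒ : ∀ p a {Φ Ψ x} → AgreeOff p Φ Ψ → x ∈ₒ 𝔸 p a Φ → x ∈ₒ 𝔸 p a Ψ ⊎ x ∈ₒ Φ p
  𝔸-∈ₒ p (call pp q Ys) {Φ} {Ψ} agree with q Fin.≟ p
  ... | yes refl = λ x∈ →
    [ inj₂ ∘ relabel-∈ₒ (rename (args q) Ys) (Φ q) , inj₁ ∘ ⊔-∈ₒʳ (renameI (args q) Ys (Ψ q)) _ ]′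
      (⊔-∈ₒ (renameI (args q) Ys (Φ q)) _ x∈)
  ... | no q≢p rewrite agree q q≢p = inj₁
  𝔸-∈ₒ p (decons pp V f Ys) _ = inj₁
  𝔸-∈ₒ p (cons pp V f Ys)   _ = inj₁
  𝔸-∈ₒ p (test pp V W)      _ = inj₁
  𝔸-∈ₒ p (assign pp V W)    _ = inj₁

  𝕊-∈ₒ : ∀ p Φ {x} → x ∈ₒ 𝕊 p Φ → Any (Any (λ a → x ∈ₒ 𝔸 p a Φ)) (clauses p)
  𝕊-∈ₒ p Φ x∈ =
    Any.map (λ {body} → ⨆-map-∈ₒ (λ a → 𝔸 p a Φ) body ∘ projTo-∈ₒ (args p) _) (⨆-map-∈ₒ _ (clauses p) x∈)

  atomOps : Pred nV nF nP → Env → List (OpPP {nF})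
  atomOps p Φ = concatMap (concatMap (λ a → concatMap ops (𝔸 p a Φ))) (clauses p)

  𝕊-opsWithin : ∀ p {Φ Φ₀} → AgreeOff p Φ Φ₀ → OpsWithin (atomOps p Φ₀) (Φ p) → OpsWithin (atomOps p Φ₀) (𝕊 p Φ)
  𝕊-opsWithin p {Φ} {Φ₀} agree Φp-within x∈ with find (𝕊-∈ₒ p Φ x∈)
  ... | body , body∈ , x∈body with find x∈body
  ... | a , a∈ , x∈a with 𝔸-∈ₒ p a agree x∈a
  ... | inj₂ x∈Φp = Φp-within x∈Φp
  ... | inj₁ x∈a₀ = ∈-concatMap⁺ _ (lose body∈ (∈-concatMap⁺ _ (lose a∈ (∈ₒ⇒∈concatMap x∈a₀))))

  Unprocessed : Subset nP → Env → Set
  Unprocessed PS Φ = ∀ q → q ∈ₛ PS → Φ q ≡ ⊥I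

  next : Pred nV nF nP → Env → Env
  next p Φ = update Φ p (𝕊 p Φ)

  -- Φ₀ is the environment at the moment p was selected.
  record Iterating (PS : Subset nP) (p : Pred nV nF nP) (Φ₀ Φ : Env) : Set where
    field
      selected  : p ∈ₛ PS
      pending   : Unprocessed PS Φ₀
      frozen    : AgreeOff p Φ Φ₀
      ascending : Φ p ⊑ 𝕊 p Φ
      bounded   : OpsWithin (atomOps p Φ₀) (Φ p)

  Iterating-select : ∀ {PS p Φ} → p ∈ₛ PS → Unprocessed PS Φ → Iterating PS p Φ Φ
  Iterating-select {p = p} {Φ} p∈ pend = record
    { selected  = p∈
    ; pending   = pend
    ; frozen    = λ _ _ → refl
    ; ascending = subst (_⊑ 𝕊 p Φ) (sym Φp≡⊥I) λ ()
    ; bounded   = subst (OpsWithin (atomOps p Φ)) (sym Φp≡⊥I) λ { (_ , _ , ()) }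
    }
    where Φp≡⊥I = pend p p∈

  module _ {PS p Φ₀ Φ} (it : Iterating PS p Φ₀ Φ) where
    open Iterating it

    private
      next-p : next p Φ p ≡ 𝕊 p Φ
      next-p = update-≡ Φ p (𝕊 p Φ)

      ascending′ : Φ p ⊑ next p Φ p
      ascending′ = subst (Φ p ⊑_) (sym next-p) ascending

      bounded′ : OpsWithin (atomOps p Φ₀) (next p Φ p)
      bounded′ = subst (OpsWithin (atomOps p Φ₀)) (sym next-p) (𝕊-opsWithin p frozen bounded)

    Iterating-next : Iterating PS p Φ₀ (next p Φ)
    Iterating-next = record
      { selected  = selected
      ; pending   = pending
      ; frozen    = λ q q≢p → trans (update-≢ Φ p (𝕊 p Φ) q q≢p) (frozen q q≢p)
      ; ascending = subst (_⊑ 𝕊 p (next p Φ)) (sym next-p)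
                          (𝕊-mono p (λ q q≢p → sym (update-≢ Φ p (𝕊 p Φ) q q≢p)) ascending′)
      ; bounded   = bounded′
      }

    missing-next-< : ¬ (𝕊 p Φ ≈I Φ p)
                        → missing (factsOver (atomOps p Φ₀)) (next p Φ p) < missing (factsOver (atomOps p Φ₀)) (Φ p)
    missing-next-< 𝕊≉Φp = missing-< (atomOps p Φ₀) ascending′ bounded′ (𝕊≉Φp ∘ subst (_≈I Φ p) next-p)

    Unprocessed-remove : Unprocessed (PS ─ ⁅ p ⁆) Φ
    Unprocessed-remove q q∈ =
      trans (frozen q λ { refl → x∈p─q⇒x∉q PS ⁅ p ⁆ q∈ (x∈⁅x⁆ p) }) (pending q (p─q⊆p PS ⁅ p ⁆ q∈))

  acc-idle : ∀ n {PS Φ} → ∣ PS ∣ < n → Unprocessed PS Φ → Acc (flip Step) ⟨ PS , nothing , Φ ⟩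
  acc-iterating : ∀ n m {PS p Φ₀ Φ} → ∣ PS ∣ ≤ n → Iterating PS p Φ₀ Φ
                → missing (factsOver (atomOps p Φ₀)) (Φ p) < m → Acc (flip Step) ⟨ PS , just p , Φ ⟩

  acc-idle zero () _
  acc-idle (suc n) {Φ = Φ} |PS|<1+n pend = acc λ where
    (select {p = p} (p∈ , _)) →
      acc-iterating n _ (ℕ.≤-pred |PS|<1+n) (Iterating-select p∈ pend)
                    (ℕ.n<1+n (missing (factsOver (atomOps p Φ)) (Φ p)))

  acc-iterating n (suc m) |PS|≤n it missing<1+m = acc λ where
    (iter 𝕊≉Φp) → acc-iterating n m |PS|≤n (Iterating-next it)
                    (ℕ.<-≤-trans (missing-next-< it 𝕊≉Φp) (ℕ.≤-pred missing<1+m))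
    (done _) → acc-idle n (ℕ.<-≤-trans (x∈p⇒∣p-x∣<∣p∣ (Iterating.selected it)) |PS|≤n)
                          (Unprocessed-remove it)
  acc-iterating n zero _ _ ()

  initial-acc : Acc (flip Step) initial
  initial-acc = acc-idle (suc nP) (s≤s (∣p∣≤n Subset.⊤)) λ _ _ → refl

proposition2 : (nV nF nP : ℕ) (P : Program nV nF nP)
    → HeadsDistinct P → UniqueProgramPoints P → DirectlyRecursive P
    → (_≤_ : Rel (ArgProfile nF) 0ℓ) (≤-dto : IsDecTotalOrder _≡_ _≤_)
    → Acc (λ s′ s → Analysis.Step P _≤_ ≤-dto s s′) (Analysis.initial P _≤_ ≤-dto)
proposition2 nV nF nP P _ _ _ _≤_ ≤-dto = Termination.initial-acc P _≤_ ≤-dto
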